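{- For $n\ge1$ and all $k$, the numbers $T(n,k)$ satisfy $$T(n,k)=\lceil k/2\rceil\,T(n-1,k)+T(n-1,k-1)+(n-k+1)\,T(n-1,k-2),$$ with $T(0,0)=1$, $T(0,k)=0$ for $k>0$, and $T(n,k)=0$ for $k<0$.
   Context: A permutation $\pi\in\mathfrak{S}_n$ is called simsun if for every $k$, the subword of $\pi$ consisting of the letters in $[k]$ (in the order they appear) contains no three consecutive entries $a>b>c$. Let $\mathcal{RS}_n$ be the set of simsun permutations of $[n]$. For $\pi\in\mathfrak{S}_n$ with $n\ge1$, the number of up-down runs ${\rm uprun}(\pi)$ is the number of alternating runs (maximal monotone consecutive segments) of the word $0\,\pi(1)\pi(2)\cdots\pi(n)$, i.e. one plus the number of interior positions of this word at which it changes direction; e.g. ${\rm uprun}(514623)=5$. Let $T(n,k)=\#\{\pi\in\mathcal{RS}_n:{\rm uprun}(\pi)=k\}$ for $n\ge1$. -}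

module Defs where

open import Data.Bool using (Bool; true; false; _∧_; _∨_; not; if_then_else_)
open import Data.Nat as ℕ using (ℕ; zero; suc; _<ᵇ_; _≤ᵇ_; _/_)
open import Data.List using (List; []; _∷_; map; concatMap; filter; length; upTo; allFin)
open import Data.Integer as ℤ using (ℤ; +_; -[1+_]; -_)
import Data.Integer.Properties as ℤP
open import Relation.Nullary.Decidable.Core using () renaming (T? to isTrue?)
open import Relation.Nullary.Decidable using (does; ⌊_⌋)
open import Data.List.Relation.Unary.Unique.DecPropositional ℕ._≟_ using (unique?)

-- Words (one-line notation) are lists of natural numbers; a permutation of [n]
-- is written π(1) π(2) ... π(n).

words : ℕ → ℕ → List (List ℕ)
words m zero    = [] ∷ []
words m (suc l) = concatMap (λ w → map (λ a → a ∷ w) (map suc (upTo m))) (words m l)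

perms : ℕ → List (List ℕ)
perms n = filter (λ w → unique? w) (words n n)

noDoubleDescent : List ℕ → Bool
noDoubleDescent (a ∷ b ∷ c ∷ rest) =
  not ((b <ᵇ a) ∧ (c <ᵇ b)) ∧ noDoubleDescent (b ∷ c ∷ rest)
noDoubleDescent _ = true

restrict : ℕ → List ℕ → List ℕ
restrict k w = filter (λ a → a ℕ.≤? k) w

-- simsun: for every k (k = 1,…,n; k = 0 and k > n add nothing new, but we
-- check all k ≤ n), the restriction to [k] has no double descent
allBelow : ℕ → (ℕ → Bool) → Bool
allBelow zero    p = p zero
allBelow (suc k) p = p (suc k) ∧ allBelow k p

isSimsun : ℕ → List ℕ → Bool
isSimsun n w = allBelow n (λ k → noDoubleDescent (restrict k w))

-- number of interior positions at which the word changes direction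
-- (entries are distinct in our uses, so each step is strictly up or down)
xor : Bool → Bool → Bool
xor true  b = not b
xor false b = b

turns : List ℕ → ℕ
turns (a ∷ b ∷ c ∷ rest) =
  (if xor (a <ᵇ b) (b <ᵇ c) then 1 else 0) ℕ.+ turns (b ∷ c ∷ rest)
turns _ = 0

-- uprun(π) = number of alternating runs of 0 π(1) ... π(n)
uprun : List ℕ → ℕ
uprun w = suc (turns (0 ∷ w))

-- T(n,k), with the conventions T(0,0)=1, T(0,k)=0 (k ≠ 0), T(n,k)=0 for k<0
-- (for n ≥ 1 and k < 0 the count below is automatically 0)
T : ℕ → ℤ → ℤ
T zero    k = if ⌊ k ℤ.≟ + 0 ⌋ then + 1 else + 0
T (suc n) k =
  + length (filter (λ w → isTrue? (isSimsun (suc n) w ∧ ⌊ + uprun w ℤ.≟ k ⌋)) (perms (suc n)))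

ceilHalf : ℤ → ℤ
ceilHalf (+ m)     = + (suc m / 2)
ceilHalf -[1+ m ]  = - (+ (suc m / 2))

-- Every permutation of [n+1] arises exactly once by inserting n+1 into a permutation σ of [n], and the
-- result is simsun iff σ is simsun and the result has no double descent, since the restrictions to [k],
-- k ≤ n, do not see the letter n+1. Let σ be simsun with u up-down runs; then 0σ has ⌊u/2⌋ descents,
-- each a single step. Inserting n+1 just before the top of a descent creates a double descent. Inserting
-- it just before the bottom of a descent, or at the end when σ ends with an ascent, keeps u runs
-- (⌈u/2⌉ positions). Exactly one position, the end or just before the last letter, adds one run. Each of
-- the remaining n-u positions lies inside an ascent, which it splits into three runs. Summing over σ
-- gives the recurrence.
module Submission where

open import Defs

module Permutations where

  open import Data.Bool using (Bool; true; false; _∧_)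
  open import Data.Bool.Properties using (∧-zeroʳ)
  open import Data.Empty using (⊥-elim)
  open import Data.List using (List; []; _∷_; map; filter; length; concatMap; upTo; _++_)
  open import Data.List.Properties using (∷-injectiveˡ; ∷-injectiveʳ; filter-all; filter-reject)
  open import Data.List.Membership.Propositional using (_∈_; _∉_; find; lose)
  open import Data.List.Membership.Propositional.Properties
    using (∈-map⁺; ∈-map⁻; ∈-upTo⁺; ∈-upTo⁻; ∈-concatMap⁺; ∈-concatMap⁻; ∈-filter⁺; ∈-filter⁻)
  open import Data.List.Membership.Propositional.Properties.WithK using (unique∧set⇒bag)
  open import Data.List.Relation.Unary.Any using (here; there)
  open import Data.List.Relation.Unary.All as All using (All; []; _∷_)
  open import Data.List.Relation.Unary.AllPairs using ([]; _∷_)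
  open import Data.List.Relation.Unary.Unique.Propositional using (Unique)
  import Data.List.Relation.Unary.Unique.Propositional.Properties as Unique
  open import Data.List.Relation.Binary.BagAndSetEquality using (∼bag⇒↭)
  open import Data.List.Relation.Binary.Permutation.Propositional using (_↭_)
  open import Data.List.Relation.Binary.Permutation.Propositional.Properties using (↭-length; filter-↭)
  open import Data.Nat using (ℕ; zero; suc; _+_; _≤_; _<_; _≤?_; _≤ᵇ_; _≟_; z≤n; s≤s)
  open import Data.Nat.Properties
    using (+-assoc; suc-injective; ≤-refl; ≤-trans; <-irrefl; <-≤-trans; n≤1+n; m≤n⇒m≤1+n; ≤∧≢⇒<; m<1+n⇒m≤n; <⇒≱)
  open import Data.List.Membership.DecPropositional _≟_ using (_∈?_)
  open import Data.List.Relation.Unary.Unique.DecPropositional _≟_ using (unique?)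
  open import Data.Product using (_×_; _,_; proj₂; Σ-syntax)
  open import Function using (_∘_; mk⇔)
  open import Relation.Binary.PropositionalEquality
  open import Relation.Nullary using (yes; no)
  open import Relation.Nullary.Decidable.Core using (T?)

  private variable
    A B : Set
    a k x n : ℕ
    p q : ℕ → Bool
    σ w : List ℕ

  bit : Bool → ℕ
  bit true  = 1
  bit false = 0

  count : (A → Bool) → List A → ℕ
  count p []       = 0
  count p (x ∷ xs) = bit (p x) + count p xs

  length-filter-T? : (p : A → Bool) (xs : List A) → length (filter (T? ∘ p) xs) ≡ count p xs
  length-filter-T? p []       = refl
  length-filter-T? p (x ∷ xs) with p x
  ... | true  = cong suc (length-filter-T? p xs)
  ... | false = length-filter-T? p xs

  count-↭ : (p : A → Bool) {xs ys : List A} → xs ↭ ys → count p xs ≡ count p ys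
  count-↭ p {xs} {ys} xs↭ys = begin
    count p xs                  ≡⟨ length-filter-T? p xs ⟨
    length (filter (T? ∘ p) xs) ≡⟨ ↭-length (filter-↭ (T? ∘ p) xs↭ys) ⟩
    length (filter (T? ∘ p) ys) ≡⟨ length-filter-T? p ys ⟩
    count p ys                  ∎
    where open ≡-Reasoning

  count-++ : (p : A → Bool) (xs ys : List A) → count p (xs ++ ys) ≡ count p xs + count p ys
  count-++ p []       ys = refl
  count-++ p (x ∷ xs) ys = trans (cong (bit (p x) +_) (count-++ p xs ys)) (sym (+-assoc (bit (p x)) _ _))

  count-map : (p : B → Bool) (f : A → B) (xs : List A) → count p (map f xs) ≡ count (p ∘ f) xs
  count-map p f []       = refl
  count-map p f (x ∷ xs) = cong (bit (p (f x)) +_) (count-map p f xs)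

  count-cong : {p q : A → Bool} (xs : List A) → (∀ x → x ∈ xs → p x ≡ q x) → count p xs ≡ count q xs
  count-cong []       eq = refl
  count-cong (x ∷ xs) eq = cong₂ _+_ (cong bit (eq x (here refl))) (count-cong xs (λ y y∈ → eq y (there y∈)))

  count-false : (xs : List A) → count (λ _ → false) xs ≡ 0
  count-false []       = refl
  count-false (x ∷ xs) = count-false xs

  count-∧-false : (p : A → Bool) (xs : List A) → count (λ x → p x ∧ false) xs ≡ 0
  count-∧-false p xs = trans (count-cong xs (λ x _ → ∧-zeroʳ (p x))) (count-false xs)

  Letter : ℕ → ℕ → Set
  Letter n a = 0 < a × a ≤ n

  ∈-letters⁻ : a ∈ map suc (upTo n) → Letter n a
  ∈-letters⁻ a∈ with ∈-map⁻ suc a∈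
  ... | b , b∈ , refl = s≤s z≤n , ∈-upTo⁻ b∈

  ∈-letters⁺ : Letter n a → a ∈ map suc (upTo n)
  ∈-letters⁺ {a = suc b} (_ , b<n) = ∈-map⁺ suc (∈-upTo⁺ b<n)

  private
    prepend : ℕ → List ℕ → List (List ℕ)
    prepend n w = map (_∷ w) (map suc (upTo n))

  ∈-words⁻ : ∀ n l → w ∈ words n l → length w ≡ l × All (Letter n) w
  ∈-words⁻ n zero    (here refl) = refl , []
  ∈-words⁻ n (suc l) w∈ with find (∈-concatMap⁻ (prepend n) {xs = words n l} w∈)
  ... | v , v∈ , w∈′ with ∈-map⁻ (_∷ v) w∈′
  ... | a , a∈ , refl with ∈-words⁻ n l v∈
  ... | len , letters = cong suc len , ∈-letters⁻ a∈ ∷ letters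

  ∈-words⁺ : ∀ n l → length w ≡ l → All (Letter n) w → w ∈ words n l
  ∈-words⁺ {[]}    n zero    _   _              = here refl
  ∈-words⁺ {a ∷ w} n (suc l) len (a-ok ∷ w-ok) =
    ∈-concatMap⁺ (prepend n) {xs = words n l}
      (lose (∈-words⁺ n l (suc-injective len) w-ok) (∈-map⁺ (_∷ w) (∈-letters⁺ a-ok)))

  concatMap-unique : (f : A → List B) (xs : List A) → Unique xs →
    (∀ {x} → x ∈ xs → Unique (f x)) →
    (∀ {x y z} → x ∈ xs → y ∈ xs → z ∈ f x → z ∈ f y → x ≡ y) →
    Unique (concatMap f xs)
  concatMap-unique f []       _             _      _        = []
  concatMap-unique f (x ∷ xs) (x∉xs ∷ uxs) unique disjoint =
    Unique.++⁺ (unique (here refl))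
      (concatMap-unique f xs uxs (unique ∘ there) (λ p q → disjoint (there p) (there q)))
      λ { (z∈fx , z∈rest) →
          let (y , y∈ , z∈fy) = find (∈-concatMap⁻ f {xs = xs} z∈rest)
          in All.lookup x∉xs y∈ (disjoint (here refl) (there y∈) z∈fx z∈fy) }

  words-unique : ∀ n l → Unique (words n l)
  words-unique n zero    = [] ∷ []
  words-unique n (suc l) =
    concatMap-unique (prepend n) (words n l) (words-unique n l)
      (λ _ → Unique.map⁺ ∷-injectiveˡ (Unique.map⁺ suc-injective (Unique.upTo⁺ n)))
      (λ _ _ → same-tail)
    where
    same-tail : ∀ {v v′ z} → z ∈ prepend n v → z ∈ prepend n v′ → v ≡ v′
    same-tail p q with ∈-map⁻ (_∷ _) p | ∈-map⁻ (_∷ _) q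
    ... | _ , _ , refl | _ , _ , eq = ∷-injectiveʳ eq

  IsPermutation : ℕ → List ℕ → Set
  IsPermutation n w = length w ≡ n × All (Letter n) w × Unique w

  ∈-perms⁻ : ∀ n → w ∈ perms n → IsPermutation n w
  ∈-perms⁻ n w∈ with ∈-filter⁻ unique? {xs = words n n} w∈
  ... | w∈words , uw with ∈-words⁻ n n w∈words
  ... | len , letters = len , letters , uw

  ∈-perms⁺ : ∀ n → IsPermutation n w → w ∈ perms n
  ∈-perms⁺ n (len , letters , uw) = ∈-filter⁺ unique? (∈-words⁺ n n len letters) uw

  perms-unique : ∀ n → Unique (perms n)
  perms-unique n = Unique.filter⁺ unique? (words-unique n n)

  inserts : ℕ → List ℕ → List (List ℕ)
  inserts x []       = (x ∷ []) ∷ []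
  inserts x (a ∷ σ) = (x ∷ a ∷ σ) ∷ map (a ∷_) (inserts x σ)

  data Insert (x : ℕ) : List ℕ → List ℕ → Set where
    here  : Insert x σ (x ∷ σ)
    there : Insert x σ w → Insert x (a ∷ σ) (a ∷ w)

  ∈-inserts⁻ : ∀ σ → w ∈ inserts x σ → Insert x σ w
  ∈-inserts⁻ []      (here refl) = here
  ∈-inserts⁻ (a ∷ σ) (here refl) = here
  ∈-inserts⁻ (a ∷ σ) (there w∈) with ∈-map⁻ (a ∷_) w∈
  ... | _ , w∈′ , refl = there (∈-inserts⁻ σ w∈′)

  ∈-inserts⁺ : Insert x σ w → w ∈ inserts x σ
  ∈-inserts⁺ {σ = []}    here      = here refl
  ∈-inserts⁺ {σ = _ ∷ _} here      = here refl
  ∈-inserts⁺ (there {a = a} ins)   = there (∈-map⁺ (a ∷_) (∈-inserts⁺ ins))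

  Insert-length : Insert x σ w → length w ≡ suc (length σ)
  Insert-length here        = refl
  Insert-length (there ins) = cong suc (Insert-length ins)

  Insert-All : {P : ℕ → Set} → P x → All P σ → Insert x σ w → All P w
  Insert-All px pσ        here        = px ∷ pσ
  Insert-All px (pa ∷ pσ) (there ins) = pa ∷ Insert-All px pσ ins

  Insert-⊆ : Insert x σ w → a ∈ σ → a ∈ w
  Insert-⊆ here        a∈       = there a∈
  Insert-⊆ (there ins) (here e)  = here e
  Insert-⊆ (there ins) (there a∈) = there (Insert-⊆ ins a∈)

  Insert-unique : Unique σ → x ∉ σ → Insert x σ w → Unique w
  Insert-unique uσ x∉σ here = All.tabulate (λ a∈ x≡a → x∉σ (subst (_∈ _) (sym x≡a) a∈)) ∷ uσ
  Insert-unique (a∉σ ∷ uσ) x∉σ (there ins) =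
    Insert-All (λ a≡x → x∉σ (here (sym a≡x))) a∉σ ins ∷ Insert-unique uσ (x∉σ ∘ there) ins

  Insert-split : x ∈ w → Unique w → Σ[ σ ∈ List ℕ ] Insert x σ w × Unique σ × x ∉ σ
  Insert-split {w = _ ∷ σ} (here refl) (x∉σ ∷ uσ) =
    σ , here , uσ , λ x∈σ → All.lookup x∉σ x∈σ refl
  Insert-split {w = a ∷ w} (there x∈w) (a∉w ∷ uw) with Insert-split x∈w uw
  ... | σ , ins , uσ , x∉σ =
    a ∷ σ , there ins , All.tabulate (All.lookup a∉w ∘ Insert-⊆ ins) ∷ uσ ,
    λ { (here refl) → All.lookup a∉w x∈w refl ; (there x∈σ) → x∉σ x∈σ }

  Insert-injective : ∀ {σ τ} → Insert x σ w → Insert x τ w → x ∉ σ → x ∉ τ → σ ≡ τ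
  Insert-injective here        here        _   _   = refl
  Insert-injective here        (there _)   _   x∉τ = ⊥-elim (x∉τ (here refl))
  Insert-injective (there _)   here        x∉σ _   = ⊥-elim (x∉σ (here refl))
  Insert-injective (there ins) (there ins′) x∉σ x∉τ =
    cong (_ ∷_) (Insert-injective ins ins′ (x∉σ ∘ there) (x∉τ ∘ there))

  inserts-unique : ∀ σ → x ∉ σ → Unique (inserts x σ)
  inserts-unique []      _   = [] ∷ []
  inserts-unique {x} (a ∷ σ) x∉aσ =
    All.tabulate head-fresh ∷ Unique.map⁺ ∷-injectiveʳ (inserts-unique σ (x∉aσ ∘ there))
    where
    head-fresh : ∀ {z} → z ∈ map (a ∷_) (inserts x σ) → x ∷ a ∷ σ ≢ z
    head-fresh z∈ eq with ∈-map⁻ (a ∷_) z∈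
    ... | _ , _ , refl = x∉aσ (here (∷-injectiveˡ eq))

  private
    lower : All (Letter (suc n)) w → suc n ∉ w → All (Letter n) w
    lower letters n+1∉w = All.tabulate λ a∈ →
      let (0<a , a≤n+1) = All.lookup letters a∈
      in 0<a , m<1+n⇒m≤n (≤∧≢⇒< a≤n+1 λ a≡n+1 → n+1∉w (subst (_∈ _) a≡n+1 a∈))

    restrict-letters : Insert x σ w → All (Letter n) w → All (Letter n) σ
    restrict-letters ins letters = All.tabulate (All.lookup letters ∘ Insert-⊆ ins)

  unique-length-≤ : ∀ n {w} → Unique w → All (Letter n) w → length w ≤ n
  unique-length-≤ zero    {[]}    _  _               = z≤n
  unique-length-≤ zero    {_ ∷ _} _  ((0<a , a≤0) ∷ _) = ⊥-elim (<-irrefl refl (<-≤-trans 0<a a≤0))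
  unique-length-≤ (suc n) {w} uw letters with suc n ∈? w
  ... | no n+1∉w = ≤-trans (unique-length-≤ n uw (lower letters n+1∉w)) (n≤1+n n)
  ... | yes n+1∈w with Insert-split n+1∈w uw
  ... | σ , ins , uσ , n+1∉σ rewrite Insert-length ins =
    s≤s (unique-length-≤ n uσ (lower (restrict-letters ins letters) n+1∉σ))

  max∈permutation : ∀ n {w} → IsPermutation (suc n) w → suc n ∈ w
  max∈permutation n {w} (len , letters , uw) with suc n ∈? w
  ... | yes n+1∈w = n+1∈w
  ... | no  n+1∉w = ⊥-elim (<-irrefl refl (subst (_≤ n) len (unique-length-≤ n uw (lower letters n+1∉w))))

  max∉perms : σ ∈ perms n → suc n ∉ σ
  max∉perms {n = n} σ∈ n+1∈σ =
    let (_ , letters , _) = ∈-perms⁻ n σ∈ in <-irrefl refl (proj₂ (All.lookup letters n+1∈σ))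

  private
    extensions-unique : ∀ n → Unique (concatMap (inserts (suc n)) (perms n))
    extensions-unique n = concatMap-unique (inserts (suc n)) (perms n) (perms-unique n)
      (λ {σ} σ∈ → inserts-unique σ (max∉perms σ∈))
      (λ {σ} {τ} σ∈ τ∈ w∈ w∈′ →
        Insert-injective (∈-inserts⁻ σ w∈) (∈-inserts⁻ τ w∈′) (max∉perms σ∈) (max∉perms τ∈))

    ∈-extensions⁻ : ∀ n → w ∈ concatMap (inserts (suc n)) (perms n) → w ∈ perms (suc n)
    ∈-extensions⁻ n w∈ with find (∈-concatMap⁻ (inserts (suc n)) {xs = perms n} w∈)
    ... | σ , σ∈ , w∈σ with ∈-perms⁻ n σ∈ | ∈-inserts⁻ σ w∈σ
    ... | len , letters , uσ | ins = ∈-perms⁺ (suc n)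
      ( trans (Insert-length ins) (cong suc len)
      , Insert-All (s≤s z≤n , ≤-refl) (All.map (λ (0<a , a≤n) → 0<a , m≤n⇒m≤1+n a≤n) letters) ins
      , Insert-unique uσ (max∉perms σ∈) ins )

    ∈-extensions⁺ : ∀ n → w ∈ perms (suc n) → w ∈ concatMap (inserts (suc n)) (perms n)
    ∈-extensions⁺ n w∈ with ∈-perms⁻ (suc n) w∈
    ... | perm@(len , letters , uw) with Insert-split (max∈permutation n perm) uw
    ... | σ , ins , uσ , n+1∉σ =
      ∈-concatMap⁺ (inserts (suc n)) {xs = perms n}
        (lose (∈-perms⁺ n ( suc-injective (trans (sym (Insert-length ins)) len)
                          , lower (restrict-letters ins letters) n+1∉σ , uσ))
              (∈-inserts⁺ ins))

  perms-suc-↭ : ∀ n → perms (suc n) ↭ concatMap (inserts (suc n)) (perms n)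
  perms-suc-↭ n = ∼bag⇒↭ (unique∧set⇒bag (perms-unique (suc n)) (extensions-unique n)
                                        (mk⇔ (∈-extensions⁺ n) (∈-extensions⁻ n)))

  allBelow-cong : ∀ n → (∀ k → k ≤ n → p k ≡ q k) → allBelow n p ≡ allBelow n q
  allBelow-cong zero    eq = eq zero z≤n
  allBelow-cong (suc n) eq = cong₂ _∧_ (eq (suc n) ≤-refl) (allBelow-cong n λ k k≤n → eq k (m≤n⇒m≤1+n k≤n))

  allBelow⇒top : ∀ n → allBelow n p ≡ true → p n ≡ true
  allBelow⇒top {p} zero    holds = holds
  allBelow⇒top {p} (suc n) holds with p (suc n)
  ... | true  = refl
  ... | false = holds

  restrict-insert : k < x → Insert x σ w → restrict k w ≡ restrict k σ
  restrict-insert {k} k<x here = filter-reject (_≤? k) (<⇒≱ k<x)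
  restrict-insert {k} k<x (there {a = a} ins) with a ≤ᵇ k
  ... | true  = cong (a ∷_) (restrict-insert k<x ins)
  ... | false = restrict-insert k<x ins

  restrict-all : All (_≤ k) w → restrict k w ≡ w
  restrict-all {k} = filter-all (_≤? k)

  isSimsun-insert-max : All (_≤ suc n) w → Insert (suc n) σ w →
    isSimsun (suc n) w ≡ noDoubleDescent w ∧ isSimsun n σ
  isSimsun-insert-max {n} w≤ ins =
    cong₂ _∧_ (cong noDoubleDescent (restrict-all w≤))
              (allBelow-cong n λ k k≤n → cong noDoubleDescent (restrict-insert (s≤s k≤n) ins))

  isSimsun⇒noDoubleDescent : ∀ n → All (_≤ n) σ → isSimsun n σ ≡ true → noDoubleDescent σ ≡ true
  isSimsun⇒noDoubleDescent {σ} n σ≤ simsun =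
    trans (cong noDoubleDescent (sym (restrict-all σ≤))) (allBelow⇒top n simsun)

module RunsUnderInsertion where

  open Permutations
  open import Data.Bool using (Bool; true; false; _∧_; not)
  open import Data.Bool.Properties using (T-≡; ¬-not; ∧-zeroʳ)
  open import Data.Empty using (⊥-elim)
  open import Data.List using (List; []; _∷_; length)
  open import Data.List.Membership.Propositional using (_∈_)
  open import Data.List.Relation.Unary.All using (All; []; _∷_)
  open import Data.List.Relation.Unary.Linked using (Linked; [-]; _∷_)
  open import Data.Nat using (ℕ; zero; suc; _+_; _*_; _<_; _≡ᵇ_; _<ᵇ_; ⌊_/2⌋; ⌈_/2⌉; z≤n; s≤s)
  open import Data.Nat.Properties using (+-suc; <⇒<ᵇ; <ᵇ⇒<; <-asym; <-cmp)
  open import Function using (Equivalence)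
  open import Relation.Binary.Definitions using (tri<; tri≈; tri>)
  open import Data.Nat.Tactic.RingSolver using (solve-∀)
  open import Data.Product using (_×_; _,_; Σ-syntax)
  open import Relation.Binary.PropositionalEquality

  private variable
    a b c x : ℕ
    as : List ℕ

  noDDTurns : ℕ → List ℕ → Bool
  noDDTurns m w = noDoubleDescent w ∧ (turns w ≡ᵇ m)

  insertionCount : ℕ → ℕ → ℕ → List ℕ → ℕ → ℕ
  insertionCount x c b as m = count (λ w → noDDTurns m (c ∷ b ∷ w)) (inserts x as)

  levels : ℕ → ℕ → ℕ → ℕ → ℕ → ℕ
  levels t A B M m = bit (t ≡ᵇ m) * A + bit (suc t ≡ᵇ m) * B + bit (suc (suc t) ≡ᵇ m) * M

  private
    +-pull-A : ∀ i j k A B M → i + (i * A + j * B + k * M) ≡ i * (1 + A) + j * B + k * M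
    +-pull-A = solve-∀

    +-pull-M : ∀ i j k A B M → k + (i * A + j * B + k * M) ≡ i * A + j * B + k * (1 + M)
    +-pull-M = solve-∀

  levels-stay : ∀ t A B M m → bit (t ≡ᵇ m) + levels t A B M m ≡ levels t (suc A) B M m
  levels-stay t A B M m = +-pull-A (bit (t ≡ᵇ m)) (bit (suc t ≡ᵇ m)) (bit (suc (suc t) ≡ᵇ m)) A B M

  levels-grow : ∀ t A B M m → bit (suc (suc t) ≡ᵇ m) + levels t A B M m ≡ levels t A B (suc M) m
  levels-grow t A B M m = +-pull-M (bit (t ≡ᵇ m)) (bit (suc t ≡ᵇ m)) (bit (suc (suc t) ≡ᵇ m)) A B M

  <⇒<ᵇ≡true : a < b → (a <ᵇ b) ≡ true
  <⇒<ᵇ≡true a<b = Equivalence.to T-≡ (<⇒<ᵇ a<b)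

  <⇒>ᵇ≡false : a < b → (b <ᵇ a) ≡ false
  <⇒>ᵇ≡false a<b = ¬-not λ b<a → <-asym a<b (<ᵇ⇒< _ _ (Equivalence.from T-≡ b<a))

  data Trend : Bool → Bool → Set where
    rise : Trend true false
    fall : Trend false true

  trend : a ≢ b → Trend (a <ᵇ b) (b <ᵇ a)
  trend {a} {b} a≢b with <-cmp a b
  ... | tri< a<b _ _ rewrite <⇒<ᵇ≡true a<b | <⇒>ᵇ≡false a<b = rise
  ... | tri≈ _ a≡b _ = ⊥-elim (a≢b a≡b)
  ... | tri> _ _ b<a rewrite <⇒<ᵇ≡true b<a | <⇒>ᵇ≡false b<a = fall

  noDoubleDescent-tail : noDoubleDescent (c ∷ b ∷ a ∷ as) ≡ true → noDoubleDescent (b ∷ a ∷ as) ≡ true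
  noDoubleDescent-tail {c} {b} {a} holds with not ((b <ᵇ c) ∧ (a <ᵇ b))
  ... | true = holds

  -- Meant for F m = the number of insertions of x after b into c b a as that have no double descent and
  -- m turns: ⌊…⌋ of them keep the t turns, one adds a turn, and M add two, one for each double ascent
  -- p < q < r of c b a as with q after b.
  ProfileOf : (ℕ → ℕ) → ℕ → ℕ → ℕ → List ℕ → Set
  ProfileOf F c b a as =
    let t = turns (c ∷ b ∷ a ∷ as) in
    Σ[ M ∈ ℕ ] (bit ((c <ᵇ b) ∧ (b <ᵇ a)) + t + M ≡ suc (length as))
             × (∀ m → F m ≡ levels t ⌊ bit (c <ᵇ b) + suc t /2⌋ 1 M m)

  Profile : ℕ → ℕ → ℕ → ℕ → List ℕ → Set
  Profile x c b a as = ProfileOf (insertionCount x c b (a ∷ as)) c b a as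

  profile-single : c ≢ b → b ≢ a → b < x → a < x → noDoubleDescent (c ∷ b ∷ a ∷ []) ≡ true →
    Profile x c b a []
  profile-single {c} {b} {a} c≢b b≢a b<x a<x noDD
    rewrite <⇒<ᵇ≡true b<x | <⇒>ᵇ≡false b<x | <⇒<ᵇ≡true a<x | <⇒>ᵇ≡false a<x
    with c <ᵇ b | b <ᵇ c | trend c≢b | b <ᵇ a | a <ᵇ b | trend b≢a
  ... | _ | _ | rise | _ | _ | rise = 0 , refl , λ { 0 → refl ; 1 → refl ; 2 → refl ; (suc (suc (suc m))) → refl }
  ... | _ | _ | rise | _ | _ | fall = 0 , refl , λ { 0 → refl ; 1 → refl ; 2 → refl ; 3 → refl ; (suc (suc (suc (suc m)))) → refl }
  ... | _ | _ | fall | _ | _ | rise = 0 , refl , λ { 0 → refl ; 1 → refl ; 2 → refl ; 3 → refl ; (suc (suc (suc (suc m)))) → refl }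
  ... | _ | _ | fall | _ | _ | fall with () ← noDD

  private
    -- The case split on the comparisons rewrites them inside every type in scope, so the count at m = 0
    -- is passed in rather than produced afterwards from lemmas about arbitrary letters.
    profile-step : ∀ {a₂ r} → c ≢ b → b ≢ a → a ≢ a₂ → b < x → a < x →
      noDoubleDescent (c ∷ b ∷ a ∷ a₂ ∷ r) ≡ true →
      bit (noDDTurns 0 (c ∷ b ∷ x ∷ a ∷ a₂ ∷ r))
        + count (λ w → noDoubleDescent (b ∷ a ∷ w) ∧ false) (inserts x (a₂ ∷ r)) ≡ 0 →
      Profile x b a a₂ r →
      ProfileOf (λ m → bit (noDDTurns m (c ∷ b ∷ x ∷ a ∷ a₂ ∷ r))
                       + count (λ w → noDDTurns m (c ∷ b ∷ a ∷ w)) (inserts x (a₂ ∷ r)))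
                c b a (a₂ ∷ r)
    profile-step {c} {b} {a} {x} {a₂} {r} c≢b b≢a a≢a₂ b<x a<x noDD at-zero (M , total , counts)
      rewrite <⇒<ᵇ≡true b<x | <⇒>ᵇ≡false b<x | <⇒<ᵇ≡true a<x | <⇒>ᵇ≡false a<x
            | noDoubleDescent-tail {b} {a} {a₂} {r} (noDoubleDescent-tail {c} {b} {a} {a₂ ∷ r} noDD)
      with c <ᵇ b | b <ᵇ c | trend c≢b | b <ᵇ a | a <ᵇ b | trend b≢a | a <ᵇ a₂ | a₂ <ᵇ a | trend a≢a₂
    ... | _ | _ | rise | _ | _ | rise | _ | _ | rise =
      suc M , trans (+-suc (suc t″) M) (cong suc total) ,
      λ m → trans (cong (bit (suc (suc t″) ≡ᵇ m) +_) (counts m)) (levels-grow t″ h 1 M m)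
      where
      t″ h : ℕ
      t″ = turns (a ∷ a₂ ∷ r)
      h  = ⌊ suc (suc t″) /2⌋
    ... | _ | _ | rise | _ | _ | rise | _ | _ | fall = M , cong suc total , counts
    ... | _ | _ | rise | _ | _ | fall | _ | _ | rise =
      M , cong suc total ,
      λ { zero → at-zero ; (suc m) → trans (cong (bit (suc t″ ≡ᵇ m) +_) (counts m)) (levels-stay (suc t″) h 1 M m) }
      where
      t″ h : ℕ
      t″ = turns (a ∷ a₂ ∷ r)
      h  = ⌊ suc (suc t″) /2⌋
    ... | _ | _ | fall | _ | _ | rise | _ | _ | rise =
      suc M , trans (+-suc (suc t″) M) (cong suc total) ,
      λ { zero → at-zero ; (suc m) → trans (cong (bit (suc (suc t″) ≡ᵇ m) +_) (counts m)) (levels-grow t″ h 1 M m) }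
      where
      t″ h : ℕ
      t″ = turns (a ∷ a₂ ∷ r)
      h  = ⌊ suc (suc t″) /2⌋
    ... | _ | _ | fall | _ | _ | rise | _ | _ | fall = M , cong suc total , λ { zero → at-zero ; (suc m) → counts m }
    ... | _ | _ | rise | _ | _ | fall | _ | _ | fall with () ← noDD
    ... | _ | _ | fall | _ | _ | fall | _ | _ | _    with () ← noDD

  peak-has-turn : b < x → a < x → noDDTurns 0 (c ∷ b ∷ x ∷ a ∷ as) ≡ false
  peak-has-turn {b} {x} {a} {c} b<x a<x
    rewrite <⇒<ᵇ≡true b<x | <⇒<ᵇ≡true a<x | <⇒>ᵇ≡false a<x with c <ᵇ b
  ... | true  = ∧-zeroʳ _
  ... | false = ∧-zeroʳ _

  ProfileOf-cong : ∀ {F G} c b a as → (∀ m → F m ≡ G m) → ProfileOf F c b a as → ProfileOf G c b a as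
  ProfileOf-cong _ _ _ _ F≗G (M , total , counts) = M , total , λ m → trans (sym (F≗G m)) (counts m)

  profile : ∀ x c b a as → Linked _≢_ (c ∷ b ∷ a ∷ as) → All (_< x) (b ∷ a ∷ as) →
    noDoubleDescent (c ∷ b ∷ a ∷ as) ≡ true → Profile x c b a as
  profile x c b a []       (c≢b ∷ b≢a ∷ [-]) (b<x ∷ a<x ∷ []) noDD = profile-single c≢b b≢a b<x a<x noDD
  profile x c b a (a₂ ∷ r) (c≢b ∷ linked@(b≢a ∷ a≢a₂ ∷ _)) (b<x ∷ below@(a<x ∷ _)) noDD =
    ProfileOf-cong c b a (a₂ ∷ r) (λ m → cong (bit (noDDTurns m (c ∷ b ∷ x ∷ a ∷ a₂ ∷ r)) +_)
                                (sym (count-map (λ w → noDDTurns m (c ∷ b ∷ w)) (a ∷_) (inserts x (a₂ ∷ r)))))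
      (profile-step {a₂ = a₂} {r} c≢b b≢a a≢a₂ b<x a<x noDD
        (cong₂ _+_ (cong bit (peak-has-turn {c = c} {as = a₂ ∷ r} b<x a<x))
                   (count-∧-false (λ w → noDoubleDescent (b ∷ a ∷ w)) (inserts x (a₂ ∷ r))))
        (profile x b a a₂ r linked below (noDoubleDescent-tail {c} {b} {a} {a₂ ∷ r} noDD)))

  runsCount : ℕ → List ℕ → ℕ → ℕ
  runsCount x σ m = count (λ w → noDoubleDescent w ∧ (uprun w ≡ᵇ m)) (inserts x σ)

  private
    noDoubleDescent-0∷ : ∀ a as → noDoubleDescent (0 ∷ suc a ∷ as) ≡ noDoubleDescent (suc a ∷ as)
    noDoubleDescent-0∷ a []      = refl
    noDoubleDescent-0∷ a (_ ∷ _) = refl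

    noDDTurns-1∷0∷ : ∀ a as m → noDDTurns m (1 ∷ 0 ∷ suc a ∷ as) ≡ (noDoubleDescent (suc a ∷ as) ∧ (uprun (suc a ∷ as) ≡ᵇ m))
    noDDTurns-1∷0∷ a []      m = refl
    noDDTurns-1∷0∷ a (_ ∷ _) m = refl

  -- Prefixing the descent 1 > 0 to 0 σ adds exactly one turn: the runs of 0 σ are the turns of 1 0 σ.
  runsCount-levels : ∀ {x a as} → 0 < a → Linked _≢_ (a ∷ as) → All (_< x) (a ∷ as) →
    noDoubleDescent (a ∷ as) ≡ true →
    Σ[ M ∈ ℕ ] (uprun (a ∷ as) + M ≡ length (a ∷ as))
             × (∀ m → runsCount x (a ∷ as) m ≡ levels (uprun (a ∷ as)) ⌈ uprun (a ∷ as) /2⌉ 1 M m)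
  runsCount-levels {suc x} {suc a} {as} (s≤s z≤n) linked below@(s≤s _ ∷ _) noDD
    with profile (suc x) 1 0 (suc a) as ((λ ()) ∷ (λ ()) ∷ linked) (s≤s z≤n ∷ below)
                 (trans (noDoubleDescent-0∷ a as) noDD)
  ... | M , total , counts = M , total , λ m → trans (count-cong (inserts (suc x) (suc a ∷ as)) (positive-head m)) (counts m)
    where
    positive-head : ∀ m w → w ∈ inserts (suc x) (suc a ∷ as) →
      noDoubleDescent w ∧ (uprun w ≡ᵇ m) ≡ noDDTurns m (1 ∷ 0 ∷ w)
    positive-head m w w∈ with ∈-inserts⁻ (suc a ∷ as) w∈
    ... | here               = sym (noDDTurns-1∷0∷ x (suc a ∷ as) m)
    ... | there {w = w′} _   = sym (noDDTurns-1∷0∷ a w′ m)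

open Permutations
open RunsUnderInsertion

open import Data.Bool using (Bool; true; false; _∧_)
open import Data.Bool.Properties using (∧-assoc; ∧-comm; T-≡)
open import Data.Integer using (ℤ; +_; -[1+_]; _+_; _-_; _*_)
import Data.Integer as ℤ
import Data.Integer.Properties as ℤ
open import Data.Integer.Tactic.RingSolver using (solve-∀)
open import Data.List using (List; []; _∷_; _++_; concatMap)
open import Data.List.Membership.Propositional using (_∈_)
open import Data.List.Relation.Unary.All as All using (All; _∷_)
open import Data.List.Relation.Unary.Any using (here; there)
open import Data.List.Relation.Unary.Linked.Properties using (AllPairs⇒Linked)
open import Data.Nat as ℕ using (ℕ; zero; suc; _≤_; _∸_; _≡ᵇ_; ⌈_/2⌉; ⌊_/2⌋; s≤s; z≤n)
import Data.Nat.Properties as ℕ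
open import Data.Nat.DivMod using (_/_; m/n≡1+[m∸n]/n)
open import Data.Product using (_,_; proj₂)
open import Function using (_∘_; Equivalence)
open import Relation.Binary.PropositionalEquality
open import Relation.Nullary.Decidable using (⌊_⌋; isYes≗does)

ι : Bool → ℤ
ι b = + bit b

∑ : {A : Set} → List A → (A → ℤ) → ℤ
∑ []       f = + 0
∑ (x ∷ xs) f = f x + ∑ xs f

∑-cong : {A : Set} {f g : A → ℤ} (xs : List A) → (∀ x → x ∈ xs → f x ≡ g x) → ∑ xs f ≡ ∑ xs g
∑-cong []       eq = refl
∑-cong (x ∷ xs) eq = cong₂ _+_ (eq x (here refl)) (∑-cong xs λ y y∈ → eq y (there y∈))

∑-ι : {A : Set} (p : A → Bool) (xs : List A) → ∑ xs (ι ∘ p) ≡ + count p xs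
∑-ι p []       = refl
∑-ι p (x ∷ xs) = trans (cong (_+_ (ι (p x))) (∑-ι p xs)) (sym (ℤ.pos-+ (bit (p x)) (count p xs)))

count-concatMap : {A B : Set} (p : B → Bool) (f : A → List B) (xs : List A) →
  + count p (concatMap f xs) ≡ ∑ xs (λ x → + count p (f x))
count-concatMap p f []       = refl
count-concatMap p f (x ∷ xs) = begin
  + count p (f x ++ concatMap f xs)              ≡⟨ cong +_ (count-++ p (f x) (concatMap f xs)) ⟩
  + (count p (f x) ℕ.+ count p (concatMap f xs)) ≡⟨ ℤ.pos-+ (count p (f x)) _ ⟩
  + count p (f x) + + count p (concatMap f xs)   ≡⟨ cong (_+_ (+ count p (f x))) (count-concatMap p f xs) ⟩
  ∑ (x ∷ xs) (λ x → + count p (f x))             ∎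
  where open ≡-Reasoning

linear-zero : ∀ a c → a * + 0 + + 0 + c * + 0 ≡ + 0
linear-zero = solve-∀

∑-linear : {A : Set} (a c : ℤ) (f g h : A → ℤ) (xs : List A) →
  ∑ xs (λ x → a * f x + g x + c * h x) ≡ a * ∑ xs f + ∑ xs g + c * ∑ xs h
∑-linear a c f g h []       = sym (linear-zero a c)
∑-linear a c f g h (x ∷ xs) =
  trans (cong (_+_ (a * f x + g x + c * h x)) (∑-linear a c f g h xs)) (regroup a c (f x) (g x) (h x) _ _ _)
  where
  regroup : ∀ a c f g h F G H → (a * f + g + c * h) + (a * F + G + c * H) ≡ a * (f + F) + (g + G) + c * (h + H)
  regroup = solve-∀

isSimsunWithRuns : ℕ → ℤ → List ℕ → Bool
isSimsunWithRuns n k w = isSimsun n w ∧ ⌊ + uprun w ℤ.≟ k ⌋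

T-as-∑ : ∀ n k → T (suc n) k ≡ ∑ (perms (suc n)) (ι ∘ isSimsunWithRuns (suc n) k)
T-as-∑ n k = trans (cong +_ (length-filter-T? P (perms (suc n)))) (sym (∑-ι P (perms (suc n))))
  where
  P : List ℕ → Bool
  P = isSimsunWithRuns (suc n) k

⌊n/2⌋≡n/2 : ∀ n → ⌊ n /2⌋ ≡ n / 2
⌊n/2⌋≡n/2 0             = refl
⌊n/2⌋≡n/2 1             = refl
⌊n/2⌋≡n/2 (suc (suc n)) = trans (cong suc (⌊n/2⌋≡n/2 n)) (sym (m/n≡1+[m∸n]/n {suc (suc n)} {2} (s≤s (s≤s z≤n))))

⌊+≟+⌋ : ∀ u m → ⌊ + u ℤ.≟ + m ⌋ ≡ (u ≡ᵇ m)
⌊+≟+⌋ u m = isYes≗does (+ u ℤ.≟ + m)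

≡ᵇ-true⇒≡ : ∀ {u m} → (u ≡ᵇ m) ≡ true → u ≡ m
≡ᵇ-true⇒≡ {u} {m} eq = ℕ.≡ᵇ⇒≡ u m (Equivalence.from T-≡ eq)

+-bit-* : ∀ (b : Bool) n z → (b ≡ true → z ≡ + n) → + (bit b ℕ.* n) ≡ z * ι b
+-bit-* false n z _  = sym (ℤ.*-zeroʳ z)
+-bit-* true  n z eq = trans (cong +_ (ℕ.+-identityʳ n)) (sym (trans (ℤ.*-identityʳ z) (eq refl)))

stay-term : ∀ u m → + (bit (u ≡ᵇ m) ℕ.* ⌈ u /2⌉) ≡ ceilHalf (+ m) * ι ⌊ + u ℤ.≟ + m ⌋
stay-term u m = trans (+-bit-* (u ≡ᵇ m) ⌈ u /2⌉ (ceilHalf (+ m)) ceilHalf≡)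
                      (cong (λ b → ceilHalf (+ m) * ι b) (sym (⌊+≟+⌋ u m)))
  where
  ceilHalf≡ : (u ≡ᵇ m) ≡ true → ceilHalf (+ m) ≡ + ⌈ u /2⌉
  ceilHalf≡ eq = trans (cong +_ (sym (⌊n/2⌋≡n/2 (suc m)))) (cong (λ v → + ⌈ v /2⌉) (sym (≡ᵇ-true⇒≡ eq)))

one-term : ∀ u m → + (bit (suc u ≡ᵇ m) ℕ.* 1) ≡ ι ⌊ + u ℤ.≟ + m - + 1 ⌋
one-term u zero    = refl
one-term u (suc m) = trans (cong +_ (ℕ.*-identityʳ _)) (cong ι (sym (⌊+≟+⌋ u m)))

grow-coefficient : ∀ u M → + suc (u ℕ.+ M) - + suc (suc u) + + 1 ≡ + M
grow-coefficient u M =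
  trans (cong₂ (λ a b → a - b + + 1) (trans (ℤ.pos-+ 1 (u ℕ.+ M)) (cong (_+_ (+ 1)) (ℤ.pos-+ u M)))
                                     (ℤ.pos-+ 2 u))
        (shuffle (+ u) (+ M))
  where
  shuffle : ∀ U M → (+ 1 + (U + M)) - (+ 2 + U) + + 1 ≡ M
  shuffle = solve-∀

grow-term : ∀ u M n m → u ℕ.+ M ≡ n →
  + (bit (suc (suc u) ≡ᵇ m) ℕ.* M) ≡ (+ suc n - + m + + 1) * ι ⌊ + u ℤ.≟ + m - + 2 ⌋
grow-term u M n 0             _       = sym (ℤ.*-zeroʳ (+ suc n - + 0 + + 1))
grow-term u M n 1             _       = sym (ℤ.*-zeroʳ (+ suc n - + 1 + + 1))
grow-term u M n (suc (suc m)) u+M≡n =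
  trans (+-bit-* (u ≡ᵇ m) M _ coefficient≡) (cong (λ b → (+ suc n - + suc (suc m) + + 1) * ι b) (sym (⌊+≟+⌋ u m)))
  where
  coefficient≡ : (u ≡ᵇ m) ≡ true → + suc n - + suc (suc m) + + 1 ≡ + M
  coefficient≡ eq = trans (cong₂ (λ n m → + suc n - + suc (suc m) + + 1) (sym u+M≡n) (sym (≡ᵇ-true⇒≡ eq)))
                          (grow-coefficient u M)

+-levels : ∀ t A B M m →
  + levels t A B M m ≡ + (bit (t ≡ᵇ m) ℕ.* A) + + (bit (suc t ≡ᵇ m) ℕ.* B) + + (bit (suc (suc t) ≡ᵇ m) ℕ.* M)
+-levels t A B M m =
  trans (ℤ.pos-+ (stay ℕ.+ one) grow) (cong (_+ + grow) (ℤ.pos-+ stay one))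
  where
  stay one grow : ℕ
  stay = bit (t ≡ᵇ m) ℕ.* A
  one  = bit (suc t ≡ᵇ m) ℕ.* B
  grow = bit (suc (suc t) ≡ᵇ m) ℕ.* M

recurrence-for-simsun : ∀ p σ k → IsPermutation (suc p) σ → isSimsun (suc p) σ ≡ true →
  + count (λ w → noDoubleDescent w ∧ ⌊ + uprun w ℤ.≟ k ⌋) (inserts (suc (suc p)) σ)
    ≡ ceilHalf k * ι ⌊ + uprun σ ℤ.≟ k ⌋ + ι ⌊ + uprun σ ℤ.≟ k - + 1 ⌋
      + (+ suc (suc p) - k + + 1) * ι ⌊ + uprun σ ℤ.≟ k - + 2 ⌋
recurrence-for-simsun p σ -[1+ j ] _ _ =
  trans (cong +_ (count-∧-false noDoubleDescent (inserts (suc (suc p)) σ)))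
        (sym (linear-zero (ceilHalf -[1+ j ]) (+ suc (suc p) - -[1+ j ] + + 1)))
recurrence-for-simsun p (a ∷ as) (+ m) (len , letters@((0<a , _) ∷ _) , unique) simsun
  with runsCount-levels 0<a (AllPairs⇒Linked unique) (All.map (s≤s ∘ proj₂) letters)
                          (isSimsun⇒noDoubleDescent (suc p) (All.map proj₂ letters) simsun)
... | M , total , counts = begin
  + count (λ w → noDoubleDescent w ∧ ⌊ + uprun w ℤ.≟ + m ⌋) (inserts (suc (suc p)) (a ∷ as))
    ≡⟨ cong +_ (count-cong (inserts (suc (suc p)) (a ∷ as)) λ w _ → cong (noDoubleDescent w ∧_) (⌊+≟+⌋ (uprun w) m)) ⟩
  + runsCount (suc (suc p)) (a ∷ as) m
    ≡⟨ cong +_ (counts m) ⟩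
  + levels u ⌈ u /2⌉ 1 M m
    ≡⟨ +-levels u ⌈ u /2⌉ 1 M m ⟩
  + (bit (u ≡ᵇ m) ℕ.* ⌈ u /2⌉) + + (bit (suc u ≡ᵇ m) ℕ.* 1) + + (bit (suc (suc u) ≡ᵇ m) ℕ.* M)
    ≡⟨ cong₂ _+_ (cong₂ _+_ (stay-term u m) (one-term u m)) (grow-term u M (suc p) m (trans total len)) ⟩
  ceilHalf (+ m) * ι ⌊ + u ℤ.≟ + m ⌋ + ι ⌊ + u ℤ.≟ + m - + 1 ⌋ + (+ suc (suc p) - + m + + 1) * ι ⌊ + u ℤ.≟ + m - + 2 ⌋ ∎
  where
  open ≡-Reasoning
  u : ℕ
  u = uprun (a ∷ as)

insertions-recurrence : ∀ p {σ} → σ ∈ perms (suc p) → ∀ k →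
  + count (isSimsunWithRuns (suc (suc p)) k) (inserts (suc (suc p)) σ)
    ≡ ceilHalf k * ι (isSimsunWithRuns (suc p) k σ) + ι (isSimsunWithRuns (suc p) (k - + 1) σ)
      + (+ suc (suc p) - k + + 1) * ι (isSimsunWithRuns (suc p) (k - + 2) σ)
insertions-recurrence p {σ} σ∈ k =
  trans (cong +_ (count-cong (inserts (suc (suc p)) σ) simsun-extension)) (by-simsun (isSimsun (suc p) σ) refl)
  where
  perm : IsPermutation (suc p) σ
  perm = ∈-perms⁻ (suc p) σ∈

  simsun-extension : ∀ w → w ∈ inserts (suc (suc p)) σ →
    isSimsunWithRuns (suc (suc p)) k w ≡ isSimsun (suc p) σ ∧ (noDoubleDescent w ∧ ⌊ + uprun w ℤ.≟ k ⌋)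
  simsun-extension w w∈ = begin
    isSimsun (suc (suc p)) w ∧ R                      ≡⟨ cong (_∧ R) (isSimsun-insert-max w≤ ins) ⟩
    (noDoubleDescent w ∧ isSimsun (suc p) σ) ∧ R      ≡⟨ cong (_∧ R) (∧-comm (noDoubleDescent w) _) ⟩
    (isSimsun (suc p) σ ∧ noDoubleDescent w) ∧ R      ≡⟨ ∧-assoc (isSimsun (suc p) σ) _ R ⟩
    isSimsun (suc p) σ ∧ (noDoubleDescent w ∧ R)      ∎
    where
    open ≡-Reasoning
    R : Bool
    R = ⌊ + uprun w ℤ.≟ k ⌋
    ins : Insert (suc (suc p)) σ w
    ins = ∈-inserts⁻ σ w∈
    w≤ : All (_≤ suc (suc p)) w
    w≤ = let (_ , letters , _) = perm in Insert-All ℕ.≤-refl (All.map (ℕ.m≤n⇒m≤1+n ∘ proj₂) letters) ins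

  by-simsun : ∀ S → isSimsun (suc p) σ ≡ S →
    + count (λ w → S ∧ (noDoubleDescent w ∧ ⌊ + uprun w ℤ.≟ k ⌋)) (inserts (suc (suc p)) σ)
      ≡ ceilHalf k * ι (S ∧ ⌊ + uprun σ ℤ.≟ k ⌋) + ι (S ∧ ⌊ + uprun σ ℤ.≟ k - + 1 ⌋)
        + (+ suc (suc p) - k + + 1) * ι (S ∧ ⌊ + uprun σ ℤ.≟ k - + 2 ⌋)
  by-simsun false _      = trans (cong +_ (count-false (inserts (suc (suc p)) σ)))
                                 (sym (linear-zero (ceilHalf k) (+ suc (suc p) - k + + 1)))
  by-simsun true  simsun = recurrence-for-simsun p σ k perm simsun

recurrence-one : ∀ k → T 1 k ≡ ceilHalf k * T 0 k + T 0 (k - + 1) + (+ 1 - k + + 1) * T 0 (k - + 2)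
recurrence-one -[1+ j ]              = sym (linear-zero (ceilHalf -[1+ j ]) (+ 1 - -[1+ j ] + + 1))
recurrence-one (+ 0)                 = refl
recurrence-one (+ 1)                 = refl
recurrence-one (+ 2)                 = refl
recurrence-one (+ suc (suc (suc j))) = sym (linear-zero (ceilHalf (+ suc (suc (suc j)))) (+ 1 - + suc (suc (suc j)) + + 1))

recurrence-suc : ∀ p k → T (suc (suc p)) k ≡
  ceilHalf k * T (suc p) k + T (suc p) (k - + 1) + (+ suc (suc p) - k + + 1) * T (suc p) (k - + 2)
recurrence-suc p k = begin
  T (suc (suc p)) k
    ≡⟨ cong +_ (length-filter-T? P (perms (suc (suc p)))) ⟩
  + count P (perms (suc (suc p)))
    ≡⟨ cong +_ (count-↭ P (perms-suc-↭ (suc p))) ⟩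
  + count P (concatMap (inserts (suc (suc p))) (perms (suc p)))
    ≡⟨ count-concatMap P (inserts (suc (suc p))) (perms (suc p)) ⟩
  ∑ (perms (suc p)) (λ σ → + count P (inserts (suc (suc p)) σ))
    ≡⟨ ∑-cong (perms (suc p)) (λ σ σ∈ → insertions-recurrence p σ∈ k) ⟩
  ∑ (perms (suc p)) (λ σ → ceilHalf k * ι (Q k σ) + ι (Q (k - + 1) σ) + c * ι (Q (k - + 2) σ))
    ≡⟨ ∑-linear (ceilHalf k) c (ι ∘ Q k) (ι ∘ Q (k - + 1)) (ι ∘ Q (k - + 2)) (perms (suc p)) ⟩
  ceilHalf k * ∑ (perms (suc p)) (ι ∘ Q k) + ∑ (perms (suc p)) (ι ∘ Q (k - + 1)) + c * ∑ (perms (suc p)) (ι ∘ Q (k - + 2))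
    ≡⟨ cong₂ _+_ (cong₂ _+_ (cong (ceilHalf k *_) (T-as-∑ p k)) (T-as-∑ p (k - + 1))) (cong (c *_) (T-as-∑ p (k - + 2))) ⟨
  ceilHalf k * T (suc p) k + T (suc p) (k - + 1) + c * T (suc p) (k - + 2) ∎
  where
  open ≡-Reasoning
  P : List ℕ → Bool
  P = isSimsunWithRuns (suc (suc p)) k
  Q : ℤ → List ℕ → Bool
  Q = isSimsunWithRuns (suc p)
  c : ℤ
  c = + suc (suc p) - k + + 1

mainTheorem7 : (n : ℕ) → 1 ≤ n → (k : ℤ) →
    T n k ≡ ceilHalf k * T (n ∸ 1) k + T (n ∸ 1) (k - + 1)
            + ((+ n - k + + 1) * T (n ∸ 1) (k - + 2))
mainTheorem7 (suc zero)    _ = recurrence-one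
mainTheorem7 (suc (suc p)) _ = recurrence-suc p
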